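{- Let $(U,\mathcal{F})$ be a set system with positive set costs $c_S$, let $f$ be the maximum number of sets of $\mathcal{F}$ containing any element, let $A \subseteq U$ be a set of active elements, and let $\beta = 32 f$. Suppose each set $S \in \mathcal{F}$ is assigned an integer level $\mathrm{level}(S) \ge b(S)$, where $b(S) = -\lceil \log_2(\beta c_S)\rceil - 1$, and every set is stable. Let $\mathcal{S} = \{S \in \mathcal{F} : \mathrm{level}(S) > b(S)\}$. Then $\sum_{S \in \mathcal{S}} c_S \le O(f^3)\cdot \mathrm{OPT}(A)$, where $\mathrm{OPT}(A)$ is the minimum cost of a subfamily of $\mathcal{F}$ covering $A$; that is, the set cover solution maintained by the algorithm is $O(f^3)$-competitive.
   Context: For an active element $e \in A$, define $\mathrm{level}(e) = \max_{S \in \mathcal{F}: e \in S} \mathrm{level}(S)$ and its dual value $y(e) = 2^{ -\mathrm{level}(e)}$. For a set $S$, $y(S) = \sum_{e \in S \cap A} y(e)$. A set $S$ is stable if: when $\mathrm{level}(S) > b(S)$, $y(S) \in [c_S/\beta, \beta c_S]$; and when $\mathrm{level}(S) = b(S)$, $y(S) < \beta c_S$. Every element of $U$ lies in at least one set of $\mathcal{F}$.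
   Formalization: The set costs $c_S$ are positive rationals. -}

module Defs where

open import Data.Nat as ℕ using (ℕ; zero; suc)
import Data.Nat.Properties as ℕP
open import Data.Integer as ℤ using (ℤ; +_; -[1+_])
open import Data.Rational as ℚ using (ℚ; 0ℚ; _/_)
open import Data.Fin using (Fin; zero; suc)
open import Data.Bool using (Bool; true; false; if_then_else_)
open import Data.Maybe using (Maybe; just; nothing)
open import Data.Product using (Σ; _×_; ∃)
open import Relation.Binary.PropositionalEquality using (_≡_)

-- A set system (U, F) with U = Fin n (elements) and F = Fin m (sets),
-- given by a membership predicate: mem S e ≡ true iff e ∈ S.
Membership : ℕ → ℕ → Set
Membership n m = Fin m → Fin n → Bool

Σℚ : ∀ {k} → (Fin k → ℚ) → ℚ
Σℚ {zero}  g = 0ℚ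
Σℚ {suc k} g = g zero ℚ.+ Σℚ (λ i → g (suc i))

count : ∀ {k} → (Fin k → Bool) → ℕ
count {zero}  p = 0
count {suc k} p = (if p zero then 1 else 0) ℕ.+ count (λ i → p (suc i))

maxℕ : ∀ {k} → (Fin k → ℕ) → ℕ
maxℕ {zero}  g = 0
maxℕ {suc k} g = g zero ℕ.⊔ maxℕ (λ i → g (suc i))

frequency : ∀ {n m} → Membership n m → ℕ
frequency {n} {m} mem = maxℕ (λ (e : Fin n) → count (λ (S : Fin m) → mem S e))

maxℤOn : ∀ {k} → (Fin k → Bool) → (Fin k → ℤ) → Maybe ℤ
maxℤOn {zero}  p g = nothing
maxℤOn {suc k} p g with maxℤOn (λ i → p (suc i)) (λ i → g (suc i))
... | r = if p zero then combine (g zero) r else r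
  where
  combine : ℤ → Maybe ℤ → Maybe ℤ
  combine z nothing  = just z
  combine z (just w) = just (z ℤ.⊔ w)

pow2 : ℤ → ℚ
pow2 (+ k)    = + (2 ℕ.^ k) / 1
pow2 -[1+ k ] = (+ 1 / (2 ℕ.^ suc k)) {{ℕP.m^n≢0 2 (suc k)}}

levelElem : ∀ {n m} → Membership n m → (Fin m → ℤ) → Fin n → Maybe ℤ
levelElem mem level e = maxℤOn (λ S → mem S e) level

-- y(e) = 2^{-level(e)} for an active element e (0 for inactive elements,
-- and for elements in no set, which is excluded by hypothesis).
yElem : ∀ {n m} → Membership n m → (Fin n → Bool) → (Fin m → ℤ) → Fin n → ℚ
yElem mem A level e with A e | levelElem mem level e
... | true  | just l  = pow2 (ℤ.- l)
... | true  | nothing = 0ℚ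
... | false | _       = 0ℚ

ySet : ∀ {n m} → Membership n m → (Fin n → Bool) → (Fin m → ℤ) → Fin m → ℚ
ySet mem A level S =
  Σℚ (λ e → if mem S e then yElem mem A level e else 0ℚ)

IsCeilLog2 : ℚ → ℤ → Set
IsCeilLog2 x k = (pow2 (k ℤ.- ℤ.1ℤ) ℚ.< x) × (x ℚ.≤ pow2 k)

-- Stability of a set S with cost c, level lvl, b = b(S), y = y(S), parameter β.
-- The lower bound y(S) ≥ c_S/β is written as c_S ≤ β·y(S) (equivalent as β > 0).
Stable : (β c : ℚ) (b lvl : ℤ) (y : ℚ) → Set
Stable β c b lvl y =
  (b ℤ.< lvl → (c ℚ.≤ β ℚ.* y) × (y ℚ.≤ β ℚ.* c)) ×
  (lvl ≡ b → y ℚ.< β ℚ.* c)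

Covers : ∀ {n m} → Membership n m → (Fin n → Bool) → (Fin m → Bool) → Set
Covers mem A C = ∀ e → A e ≡ true → ∃ λ S → (C S ≡ true) × (mem S e ≡ true)

cost : ∀ {m} → (Fin m → ℚ) → (Fin m → Bool) → ℚ
cost c C = Σℚ (λ S → if C S then c S else 0ℚ)

IsOPT : ∀ {n m} → Membership n m → (Fin m → ℚ) → (Fin n → Bool) → ℚ → Set
IsOPT mem c A v =
  (Σ (Fin _ → Bool) λ C → Covers mem A C × (cost c C ≡ v)) ×
  (∀ C → Covers mem A C → v ℚ.≤ cost c C)

ℕtoℚ : ℕ → ℚ
ℕtoℚ k = + k / 1

-- Stability makes the element duals y a near-feasible, near-tight dual
-- solution.  A set of level above b(S) is paid for by its dual load,
-- c_S ≤ β y(S); summing over all sets counts each y(e) at most f times, so the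
-- selected cost is at most β f Σ_e y(e).  Conversely every active element lies
-- in some set of an optimal cover C and y(S) ≤ β c_S for every stable set, so
-- Σ_e y(e) ≤ Σ_{S ∈ C} y(S) ≤ β OPT.  Altogether the cost is at most
-- β² f OPT = 1024 f³ OPT.
module Submission where

open import Defs
open import Data.Nat as ℕ using (ℕ)
open import Data.Integer as ℤ using (ℤ)
open import Data.Rational as ℚ using (ℚ; 0ℚ)
open import Data.Fin using (Fin)
open import Data.Bool using (Bool; true; false; if_then_else_)
open import Data.Product using (Σ; _×_; ∃)
open import Relation.Binary.PropositionalEquality using (_≡_)
open import Relation.Nullary.Decidable using (⌊_⌋)

open import Algebra.Bundles using (CommutativeRing)
open import Data.Fin using (zero; suc)
open import Data.Integer using (+_)
open import Data.Maybe using (just; nothing)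
open import Data.Nat using (zero; suc)
open import Data.Product using (_,_; proj₁; proj₂)
open import Data.Rational using (mkℚ; 1ℚ; _/_)
open import Function using (_∘_)
open import Relation.Binary.PropositionalEquality using (refl; sym; trans; cong; cong₂; subst; module ≡-Reasoning)
open import Relation.Nullary using (yes; no)
import Data.Nat.Coprimality as Coprime
open import Data.Nat.Solver using (module +-*-Solver)
import Data.Nat.Properties as ℕP
import Data.Integer.Properties as ℤP
import Data.Rational.Properties as ℚP
open import Algebra.Properties.Semiring.Sum (CommutativeRing.semiring ℚP.+-*-commutativeRing)
  using (sum; sum-replicate-zero; ∑-comm; *-distribˡ-sum)

-- In this form ℚ._+_ and ℚ._*_ of naturals compute to integer arithmetic over 1.
ℕtoℚ≡mkℚ : ∀ k → ℕtoℚ k ≡ mkℚ (+ k) 0 (Coprime.sym (Coprime.1-coprimeTo k))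
ℕtoℚ≡mkℚ k = ℚP.normalize-coprime (Coprime.sym (Coprime.1-coprimeTo k))

ℕtoℚ-+ : ∀ a b → ℕtoℚ (a ℕ.+ b) ≡ ℕtoℚ a ℚ.+ ℕtoℚ b
ℕtoℚ-+ a b = begin
  + (a ℕ.+ b) / 1                                ≡⟨ cong (_/ 1) (ℤP.pos-+ a b) ⟩
  (+ a ℤ.+ + b) / 1                              ≡⟨ cong (_/ 1) (sym (cong₂ ℤ._+_ (ℤP.*-identityʳ (+ a)) (ℤP.*-identityʳ (+ b)))) ⟩
  (+ a ℤ.* + 1 ℤ.+ + b ℤ.* + 1) / 1             ≡⟨ sym (cong₂ ℚ._+_ (ℕtoℚ≡mkℚ a) (ℕtoℚ≡mkℚ b)) ⟩
  ℕtoℚ a ℚ.+ ℕtoℚ b                              ∎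
  where open ≡-Reasoning

ℕtoℚ-* : ∀ a b → ℕtoℚ (a ℕ.* b) ≡ ℕtoℚ a ℚ.* ℕtoℚ b
ℕtoℚ-* a b =
  trans (cong (_/ 1) (ℤP.pos-* a b)) (sym (cong₂ ℚ._*_ (ℕtoℚ≡mkℚ a) (ℕtoℚ≡mkℚ b)))

ℕtoℚ-mono-≤ : ∀ {a b} → a ℕ.≤ b → ℕtoℚ a ℚ.≤ ℕtoℚ b
ℕtoℚ-mono-≤ {a} {b} a≤b
  rewrite ℕtoℚ≡mkℚ a | ℕtoℚ≡mkℚ b = ℚ.*≤* (ℤP.*-monoʳ-≤-nonNeg (+ 1) (ℤ.+≤+ a≤b))

ℕtoℚ-nonNeg : ∀ k → 0ℚ ℚ.≤ ℕtoℚ k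
ℕtoℚ-nonNeg k = ℕtoℚ-mono-≤ {0} {k} ℕ.z≤n

ℕtoℚ-*-monoˡ-≤ : ∀ k {p q} → p ℚ.≤ q → ℕtoℚ k ℚ.* p ℚ.≤ ℕtoℚ k ℚ.* q
ℕtoℚ-*-monoˡ-≤ k = ℚP.*-monoˡ-≤-nonNeg (ℕtoℚ k) {{ℚ.nonNegative (ℕtoℚ-nonNeg k)}}

ℕtoℚ-*-scale³ : ∀ a b c x →
  ℕtoℚ a ℚ.* (ℕtoℚ b ℚ.* (ℕtoℚ c ℚ.* x)) ≡ ℕtoℚ (a ℕ.* b ℕ.* c) ℚ.* x
ℕtoℚ-*-scale³ a b c x = begin
  ℕtoℚ a ℚ.* (ℕtoℚ b ℚ.* (ℕtoℚ c ℚ.* x))  ≡⟨ cong (ℕtoℚ a ℚ.*_) (sym (ℚP.*-assoc (ℕtoℚ b) (ℕtoℚ c) x)) ⟩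
  ℕtoℚ a ℚ.* (ℕtoℚ b ℚ.* ℕtoℚ c ℚ.* x)    ≡⟨ sym (ℚP.*-assoc (ℕtoℚ a) (ℕtoℚ b ℚ.* ℕtoℚ c) x) ⟩
  ℕtoℚ a ℚ.* (ℕtoℚ b ℚ.* ℕtoℚ c) ℚ.* x    ≡⟨ cong (ℚ._* x) (sym (ℚP.*-assoc (ℕtoℚ a) (ℕtoℚ b) (ℕtoℚ c))) ⟩
  ℕtoℚ a ℚ.* ℕtoℚ b ℚ.* ℕtoℚ c ℚ.* x      ≡⟨ cong (λ z → z ℚ.* ℕtoℚ c ℚ.* x) (sym (ℕtoℚ-* a b)) ⟩
  ℕtoℚ (a ℕ.* b) ℚ.* ℕtoℚ c ℚ.* x         ≡⟨ cong (ℚ._* x) (sym (ℕtoℚ-* (a ℕ.* b) c)) ⟩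
  ℕtoℚ (a ℕ.* b ℕ.* c) ℚ.* x               ∎
  where open ≡-Reasoning

Σℚ≡sum : ∀ {k} (g : Fin k → ℚ) → Σℚ g ≡ sum g
Σℚ≡sum {zero}  g = refl
Σℚ≡sum {suc k} g = cong (g zero ℚ.+_) (Σℚ≡sum (g ∘ suc))

Σℚ-cong : ∀ {k} {g h : Fin k → ℚ} → (∀ i → g i ≡ h i) → Σℚ g ≡ Σℚ h
Σℚ-cong {zero}  g≗h = refl
Σℚ-cong {suc k} g≗h = cong₂ ℚ._+_ (g≗h zero) (Σℚ-cong (g≗h ∘ suc))

Σℚ-zero : ∀ k → Σℚ {k} (λ _ → 0ℚ) ≡ 0ℚ
Σℚ-zero k = trans (Σℚ≡sum {k} (λ _ → 0ℚ)) (sum-replicate-zero k)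

Σℚ-comm : ∀ {k l} (g : Fin k → Fin l → ℚ) →
  Σℚ (λ i → Σℚ (g i)) ≡ Σℚ (λ j → Σℚ (λ i → g i j))
Σℚ-comm g = begin
  Σℚ (λ i → Σℚ (g i))             ≡⟨ Σℚ-cong (λ i → Σℚ≡sum (g i)) ⟩
  Σℚ (λ i → sum (g i))            ≡⟨ Σℚ≡sum (λ i → sum (g i)) ⟩
  sum (λ i → sum (g i))           ≡⟨ ∑-comm g ⟩
  sum (λ j → sum (λ i → g i j))   ≡⟨ Σℚ≡sum (λ j → sum (λ i → g i j)) ⟨
  Σℚ (λ j → sum (λ i → g i j))    ≡⟨ Σℚ-cong (λ j → Σℚ≡sum (λ i → g i j)) ⟨
  Σℚ (λ j → Σℚ (λ i → g i j))     ∎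
  where open ≡-Reasoning

Σℚ-scale : ∀ {k} a (g : Fin k → ℚ) → Σℚ (λ i → a ℚ.* g i) ≡ a ℚ.* Σℚ g
Σℚ-scale a g =
  trans (Σℚ≡sum (λ i → a ℚ.* g i)) (trans (sym (*-distribˡ-sum a g)) (cong (a ℚ.*_) (sym (Σℚ≡sum g))))

Σℚ-if : ∀ {k} (u : Bool) (g : Fin k → ℚ) →
  Σℚ (λ i → if u then g i else 0ℚ) ≡ (if u then Σℚ g else 0ℚ)
Σℚ-if         true  g = refl
Σℚ-if {k = k} false g = Σℚ-zero k

Σℚ-indicator : ∀ {k} (p : Fin k → Bool) v →
  Σℚ (λ i → if p i then v else 0ℚ) ≡ ℕtoℚ (count p) ℚ.* v
Σℚ-indicator {zero}  p v = sym (ℚP.*-zeroˡ v)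
Σℚ-indicator {suc k} p v with p zero
... | false = trans (ℚP.+-identityˡ _) (Σℚ-indicator (p ∘ suc) v)
... | true  = begin
  v ℚ.+ Σℚ (λ i → if p (suc i) then v else 0ℚ)  ≡⟨ cong (v ℚ.+_) (Σℚ-indicator (p ∘ suc) v) ⟩
  v ℚ.+ N ℚ.* v                                ≡⟨ cong (ℚ._+ N ℚ.* v) (ℚP.*-identityˡ v) ⟨
  1ℚ ℚ.* v ℚ.+ N ℚ.* v                         ≡⟨ ℚP.*-distribʳ-+ v 1ℚ N ⟨
  (1ℚ ℚ.+ N) ℚ.* v                             ≡⟨ cong (ℚ._* v) (ℕtoℚ-+ 1 (count (p ∘ suc))) ⟨
  ℕtoℚ (1 ℕ.+ count (p ∘ suc)) ℚ.* v           ∎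
  where
  open ≡-Reasoning
  N = ℕtoℚ (count (p ∘ suc))

Σℚ-mono-≤ : ∀ {k} {g h : Fin k → ℚ} → (∀ i → g i ℚ.≤ h i) → Σℚ g ℚ.≤ Σℚ h
Σℚ-mono-≤ {zero}  g≤h = ℚP.≤-refl
Σℚ-mono-≤ {suc k} g≤h = ℚP.+-mono-≤ (g≤h zero) (Σℚ-mono-≤ (g≤h ∘ suc))

Σℚ-mono-scale : ∀ {k} a {g h : Fin k → ℚ} →
  (∀ i → g i ℚ.≤ a ℚ.* h i) → Σℚ g ℚ.≤ a ℚ.* Σℚ h
Σℚ-mono-scale a {h = h} g≤ah = ℚP.≤-trans (Σℚ-mono-≤ g≤ah) (ℚP.≤-reflexive (Σℚ-scale a h))

Σℚ-nonNeg : ∀ {k} {g : Fin k → ℚ} → (∀ i → 0ℚ ℚ.≤ g i) → 0ℚ ℚ.≤ Σℚ g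
Σℚ-nonNeg {k} {g} 0≤g = subst (λ z → z ℚ.≤ Σℚ g) (Σℚ-zero k) (Σℚ-mono-≤ 0≤g)

term≤Σℚ : ∀ {k} {g : Fin k → ℚ} → (∀ i → 0ℚ ℚ.≤ g i) → ∀ i → g i ℚ.≤ Σℚ g
term≤Σℚ {g = g} 0≤g zero =
  subst (ℚ._≤ Σℚ g) (ℚP.+-identityʳ (g zero)) (ℚP.+-monoʳ-≤ (g zero) (Σℚ-nonNeg (0≤g ∘ suc)))
term≤Σℚ {g = g} 0≤g (suc i) =
  ℚP.≤-trans (term≤Σℚ (0≤g ∘ suc) i)
    (subst (ℚ._≤ Σℚ g) (ℚP.+-identityˡ _) (ℚP.+-monoˡ-≤ (Σℚ (g ∘ suc)) (0≤g zero)))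

if-nonNeg : ∀ u {x} → 0ℚ ℚ.≤ x → 0ℚ ℚ.≤ (if u then x else 0ℚ)
if-nonNeg true  0≤x = 0≤x
if-nonNeg false _   = ℚP.≤-refl

≤maxℕ : ∀ {k} (g : Fin k → ℕ) i → g i ℕ.≤ maxℕ g
≤maxℕ g zero    = ℕP.m≤m⊔n (g zero) _
≤maxℕ g (suc i) = ℕP.≤-trans (≤maxℕ (g ∘ suc) i) (ℕP.m≤n⊔m (g zero) _)

module _ {n m} (mem : Membership n m) where

  setWeight : (Fin n → ℚ) → Fin m → ℚ
  setWeight w S = Σℚ (λ e → if mem S e then w e else 0ℚ)

  setWeight-nonNeg : (w : Fin n → ℚ) → (∀ e → 0ℚ ℚ.≤ w e) → ∀ S → 0ℚ ℚ.≤ setWeight w S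
  setWeight-nonNeg w 0≤w S = Σℚ-nonNeg (λ e → if-nonNeg (mem S e) (0≤w e))

  Σ-setWeight≤frequency*Σ : (w : Fin n → ℚ) → (∀ e → 0ℚ ℚ.≤ w e) →
    Σℚ (setWeight w) ℚ.≤ ℕtoℚ (frequency mem) ℚ.* Σℚ w
  Σ-setWeight≤frequency*Σ w 0≤w = begin
    Σℚ (setWeight w)                                      ≡⟨ Σℚ-comm (λ S e → if mem S e then w e else 0ℚ) ⟩
    Σℚ (λ e → Σℚ (λ S → if mem S e then w e else 0ℚ))     ≤⟨ Σℚ-mono-scale (ℕtoℚ (frequency mem)) {h = w} degree-bound ⟩
    ℕtoℚ (frequency mem) ℚ.* Σℚ w                         ∎
    where
    open ℚP.≤-Reasoning
    degree-bound : ∀ e → Σℚ (λ S → if mem S e then w e else 0ℚ) ℚ.≤ ℕtoℚ (frequency mem) ℚ.* w e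
    degree-bound e = begin
      Σℚ (λ S → if mem S e then w e else 0ℚ)  ≡⟨ Σℚ-indicator (λ S → mem S e) (w e) ⟩
      ℕtoℚ (count (λ S → mem S e)) ℚ.* w e    ≤⟨ ℚP.*-monoʳ-≤-nonNeg (w e) {{ℚ.nonNegative (0≤w e)}}
                                                    (ℕtoℚ-mono-≤ (≤maxℕ (λ e′ → count (λ S → mem S e′)) e)) ⟩
      ℕtoℚ (frequency mem) ℚ.* w e            ∎

  Σ≤Σ-cover-setWeight : (A : Fin n → Bool) (C : Fin m → Bool) (w : Fin n → ℚ) →
    (∀ e → 0ℚ ℚ.≤ w e) → (∀ e → A e ≡ false → w e ≡ 0ℚ) → Covers mem A C →
    Σℚ w ℚ.≤ Σℚ (λ S → if C S then setWeight w S else 0ℚ)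
  Σ≤Σ-cover-setWeight A C w 0≤w inactive⇒0 covers = begin
    Σℚ w                            ≤⟨ Σℚ-mono-≤ (λ e → covered e (A e) refl) ⟩
    Σℚ (λ e → Σℚ (λ S → g S e))     ≡⟨ Σℚ-comm g ⟨
    Σℚ (λ S → Σℚ (g S))             ≡⟨ Σℚ-cong (λ S → Σℚ-if (C S) (λ e → if mem S e then w e else 0ℚ)) ⟩
    Σℚ (λ S → if C S then setWeight w S else 0ℚ) ∎
    where
    open ℚP.≤-Reasoning
    g : Fin m → Fin n → ℚ
    g S e = if C S then (if mem S e then w e else 0ℚ) else 0ℚ

    0≤g : ∀ S e → 0ℚ ℚ.≤ g S e
    0≤g S e = if-nonNeg (C S) (if-nonNeg (mem S e) (0≤w e))

    g-chosen : ∀ {S e} → C S ≡ true → mem S e ≡ true → g S e ≡ w e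
    g-chosen {S} {e} CS e∈S rewrite CS | e∈S = refl

    covered : ∀ e a → A e ≡ a → w e ℚ.≤ Σℚ (λ S → g S e)
    covered e false Ae = subst (ℚ._≤ Σℚ (λ S → g S e)) (sym (inactive⇒0 e Ae)) (Σℚ-nonNeg (λ S → 0≤g S e))
    covered e true  Ae with covers e Ae
    ... | S , CS , e∈S = subst (ℚ._≤ Σℚ (λ S → g S e)) (g-chosen CS e∈S) (term≤Σℚ (λ S′ → 0≤g S′ e) S)

pow2-nonNeg : ∀ z → 0ℚ ℚ.≤ pow2 z
pow2-nonNeg (+ k)      = ℕtoℚ-nonNeg (2 ℕ.^ k)
pow2-nonNeg ℤ.-[1+ k ] =
  ℚP.nonNegative⁻¹ _ {{ℚP.normalize-nonNeg 1 (2 ℕ.^ suc k) {{ℕP.m^n≢0 2 (suc k)}}}}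

yElem-nonNeg : ∀ {n m} (mem : Membership n m) A level e → 0ℚ ℚ.≤ yElem mem A level e
yElem-nonNeg mem A level e with A e | levelElem mem level e
... | true  | just l  = pow2-nonNeg (ℤ.- l)
... | true  | nothing = ℚP.≤-refl
... | false | _       = ℚP.≤-refl

yElem-inactive : ∀ {n m} (mem : Membership n m) A level e →
  A e ≡ false → yElem mem A level e ≡ 0ℚ
yElem-inactive mem A level e Ae with A e | levelElem mem level e
yElem-inactive mem A level e refl | false | _ = refl

Stable⇒y≤β*c : ∀ {β c b lvl y} → b ℤ.≤ lvl → Stable β c b lvl y → y ℚ.≤ β ℚ.* c
Stable⇒y≤β*c {b = b} {lvl} b≤lvl (raised , tight) with b ℤ.<? lvl
... | yes b<lvl = proj₂ (raised b<lvl)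
... | no  b≮lvl = ℚP.<⇒≤ (tight (ℤP.≤-antisym (ℤP.≮⇒≥ b≮lvl) b≤lvl))

Stable⇒raisedCost≤β*y : ∀ {β c b lvl y} → 0ℚ ℚ.≤ β → 0ℚ ℚ.≤ y → Stable β c b lvl y →
  (if ⌊ b ℤ.<? lvl ⌋ then c else 0ℚ) ℚ.≤ β ℚ.* y
Stable⇒raisedCost≤β*y {β} {b = b} {lvl} 0≤β 0≤y (raised , _) with b ℤ.<? lvl
... | yes b<lvl = proj₁ (raised b<lvl)
... | no  _     = subst (ℚ._≤ β ℚ.* _) (ℚP.*-zeroʳ β)
                    (ℚP.*-monoˡ-≤-nonNeg β {{ℚ.nonNegative 0≤β}} 0≤y)

raisedCost : ∀ {m} → (b level : Fin m → ℤ) → (Fin m → ℚ) → ℚ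
raisedCost b level c = Σℚ (λ S → if ⌊ b S ℤ.<? level S ⌋ then c S else 0ℚ)

raisedCost≤β²f*coverCost : ∀ {n m} (mem : Membership n m) (c : Fin m → ℚ) (A : Fin n → Bool)
  (level b : Fin m → ℤ) (k : ℕ) →
  (∀ S → b S ℤ.≤ level S) →
  (∀ S → Stable (ℕtoℚ k) (c S) (b S) (level S) (ySet mem A level S)) →
  ∀ C → Covers mem A C →
  raisedCost b level c ℚ.≤ ℕtoℚ (k ℕ.* frequency mem ℕ.* k) ℚ.* cost c C
raisedCost≤β²f*coverCost mem c A level b k b≤level stable C covers = begin
  raisedCost b level c                 ≤⟨ Σℚ-mono-scale β (λ S → Stable⇒raisedCost≤β*y (ℕtoℚ-nonNeg k) (0≤yS S) (stable S)) ⟩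
  β ℚ.* Σℚ (setWeight mem y)           ≤⟨ ℕtoℚ-*-monoˡ-≤ k (Σ-setWeight≤frequency*Σ mem y 0≤y) ⟩
  β ℚ.* (F ℚ.* Σℚ y)                   ≤⟨ ℕtoℚ-*-monoˡ-≤ k (ℕtoℚ-*-monoˡ-≤ f Σy≤β*cost) ⟩
  β ℚ.* (F ℚ.* (β ℚ.* cost c C))       ≡⟨ ℕtoℚ-*-scale³ k f k (cost c C) ⟩
  ℕtoℚ (k ℕ.* f ℕ.* k) ℚ.* cost c C    ∎
  where
  open ℚP.≤-Reasoning
  f = frequency mem
  F = ℕtoℚ f
  β = ℕtoℚ k
  y = yElem mem A level

  0≤y : ∀ e → 0ℚ ℚ.≤ y e
  0≤y = yElem-nonNeg mem A level

  0≤yS : ∀ S → 0ℚ ℚ.≤ setWeight mem y S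
  0≤yS = setWeight-nonNeg mem y 0≤y

  chosen-bound : ∀ S → (if C S then setWeight mem y S else 0ℚ) ℚ.≤ β ℚ.* (if C S then c S else 0ℚ)
  chosen-bound S with C S
  ... | true  = Stable⇒y≤β*c {β = β} (b≤level S) (stable S)
  ... | false = ℚP.≤-reflexive (sym (ℚP.*-zeroʳ β))

  Σy≤β*cost : Σℚ y ℚ.≤ β ℚ.* cost c C
  Σy≤β*cost = ℚP.≤-trans (Σ≤Σ-cover-setWeight mem A C y 0≤y (yElem-inactive mem A level) covers)
                         (Σℚ-mono-scale β chosen-bound)

32f*f*32f≡1024*f³ : ∀ f → 32 ℕ.* f ℕ.* f ℕ.* (32 ℕ.* f) ≡ 1024 ℕ.* f ℕ.^ 3
32f*f*32f≡1024*f³ = solve 1 (λ f → con 32 :* f :* f :* (con 32 :* f) := con 1024 :* f :^ 3) refl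
  where open +-*-Solver

mainTheorem3 : Σ ℕ λ K →
    ∀ {n m} (mem : Membership n m) (c : Fin m → ℚ) (A : Fin n → Bool)
    (level : Fin m → ℤ) (clog : Fin m → ℤ) →
    (∀ S → 0ℚ ℚ.< c S) →
    (∀ e → ∃ λ S → mem S e ≡ true) →
    let f = frequency mem
        β = ℕtoℚ (32 ℕ.* f)
        b = λ S → ℤ.- clog S ℤ.- ℤ.1ℤ
    in
    (∀ S → IsCeilLog2 (β ℚ.* c S) (clog S)) →
    (∀ S → b S ℤ.≤ level S) →
    (∀ S → Stable β (c S) (b S) (level S) (ySet mem A level S)) →
    (opt : ℚ) → IsOPT mem c A opt →
    Σℚ (λ S → if ⌊ b S ℤ.<? level S ⌋ then c S else 0ℚ)
    ℚ.≤ ℕtoℚ (K ℕ.* (f ℕ.^ 3)) ℚ.* opt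
mainTheorem3 = 1024 , λ mem c A level clog _ _ _ b≤level stable opt ((C , covers , cost≡opt) , _) →
  ℚP.≤-trans (raisedCost≤β²f*coverCost mem c A level _ (32 ℕ.* frequency mem) b≤level stable C covers)
             (ℚP.≤-reflexive (cong₂ (λ k x → ℕtoℚ k ℚ.* x) (32f*f*32f≡1024*f³ (frequency mem)) cost≡opt))
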